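{- Let $\Sigma_0$ be the signature with a single sort $\sigma$ and no function or predicate symbols other than equality, and let ${\cal T}^\infty_{Even}$ be the $\Sigma_0$-theory of all $\Sigma_0$-structures ${\cal A}$ such that $|\sigma^{\cal A}|$ is even or infinite. Then ${\cal T}^\infty_{Even}$ is not strongly finitely witnessable w.r.t. $\sigma$.
   Context: A ${\cal T}$-interpretation is an interpretation whose underlying structure is in ${\cal T}$; formulas are ${\cal T}$-equivalent if satisfied by the same ${\cal T}$-interpretations. $\mathit{vars}_\sigma(\phi)$ is the set of free variables of sort $\sigma$ in $\phi$, $\mathit{vars}(\phi)$ all free variables, $X^{\cal A}=\{x^{\cal A}:x\in X\}$; $QF(\Sigma)$ is the set of quantifier-free $\Sigma$-formulas. An arrangement of a finite set $V$ of variables (all of one sort) is a conjunction of $x=y$ for $(x,y)\in E$ and $x\neq y$ for $x,y\in V$ with $(x,y)\notin E$, for an equivalence relation $E$ on $V$. For a set $S$ of sorts, a ${\cal T}$-interpretation ${\cal A}$ finitely witnesses $\phi$ for ${\cal T}$ w.r.t. $S$ if ${\cal A}\models\phi$ and $s^{\cal A}=\mathit{vars}_s(\phi)^{\cal A}$ for all $s\in S$; $\phi$ is finitely witnessed if it is ${\cal T}$-unsatisfiable or has such a finite witness; $\phi$ is strongly finitely witnessed if $\phi\wedge\delta_V$ is finitely witnessed for every arrangement $\delta_V$ of every finite set $V$ of variables with sorts in $S$. A strong witness for ${\cal T}$ w.r.t. $S$ is a function $\mathit{wit}:QF(\Sigma)\to QF(\Sigma)$ such that for every $\phi$: $\phi$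 and $\exists\vec w.\mathit{wit}(\phi)$ are ${\cal T}$-equivalent, with $\vec w=\mathit{vars}(\mathit{wit}(\phi))\setminus\mathit{vars}(\phi)$, and $\mathit{wit}(\phi)$ is strongly finitely witnessed. ${\cal T}$ is strongly finitely witnessable w.r.t. $S$ if it has a computable strong witness. -}

module Defs where

open import Data.Nat using (ℕ; _≟_)
open import Data.Nat.Divisibility using (_∣_)
open import Data.Bool using (Bool; true; false; if_then_else_)
open import Data.List using (List; []; _∷_; _++_; map; concatMap; foldr; filter)
open import Data.List.Membership.Propositional using (_∈_; _∉_)
open import Data.List.Membership.DecPropositional _≟_ using (_∈?_)
open import Data.Fin using (Fin)
open import Data.Product using (Σ; _×_; ∃)
open import Data.Sum using (_⊎_)
open import Data.Unit using (⊤)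
open import Function.Bundles using (_↔_)
open import Relation.Nullary using (¬_; ¬?)
open import Relation.Binary.Definitions using (DecidableEquality)
open import Relation.Binary.PropositionalEquality using (_≡_)

_∨c_ : ∀ {a b} → Set a → Set b → Set _
A ∨c B = ¬ ¬ (A ⊎ B)

-- Syntax: quantifier-free Σ₀-formulas.  Σ₀ has one sort σ and only
-- equality, so the only terms are variables (indexed by ℕ), all of sort σ.

infix  6 _≐_
infixr 5 _∧ᶠ_ _∨ᶠ_

data Form : Set where
  ⊤ᶠ   : Form
  _≐_  : ℕ → ℕ → Form
  ¬ᶠ_  : Form → Form
  _∧ᶠ_ : Form → Form → Form
  _∨ᶠ_ : Form → Form → Form

vars : Form → List ℕ
vars ⊤ᶠ = []
vars (x ≐ y) = x ∷ y ∷ []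
vars (¬ᶠ φ) = vars φ
vars (φ ∧ᶠ ψ) = vars φ ++ vars ψ
vars (φ ∨ᶠ ψ) = vars φ ++ vars ψ

-- A Σ₀-structure: a domain for σ.  Equality is assumed decidable, which
-- holds classically for every set and makes satisfaction classical.
record Structure : Set₁ where
  field
    Carrier : Set
    _≟ᶜ_    : DecidableEquality Carrier

record Interp : Set₁ where
  field
    struct : Structure
    val    : ℕ → Structure.Carrier struct
  Dom : Set
  Dom = Structure.Carrier struct

open Interp public

_[_] : (I : Interp) → (ℕ → Dom I) → Interp
I [ v ] = record { struct = struct I ; val = v }

_⊨_ : Interp → Form → Set
I ⊨ ⊤ᶠ = ⊤
I ⊨ (x ≐ y) = val I x ≡ val I y
I ⊨ (¬ᶠ φ) = ¬ (I ⊨ φ)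
I ⊨ (φ ∧ᶠ ψ) = (I ⊨ φ) × (I ⊨ ψ)
I ⊨ (φ ∨ᶠ ψ) = (I ⊨ φ) ⊎ (I ⊨ ψ)

_⊨∃_∙_ : Interp → List ℕ → Form → Set
I ⊨∃ ws ∙ ψ = ¬ ¬ (Σ (ℕ → Dom I) λ v →
                     (∀ x → x ∉ ws → v x ≡ val I x) × ((I [ v ]) ⊨ ψ))

IsFinite : Set → Set
IsFinite A = ∃ λ n → A ↔ Fin n

EvenOrInfinite : Set → Set
EvenOrInfinite A = (∃ λ n → (2 ∣ n) × (A ↔ Fin n)) ∨c (¬ IsFinite A)

InT : Structure → Set
InT 𝒜 = EvenOrInfinite (Structure.Carrier 𝒜)

TInterp : Interp → Set
TInterp I = InT (struct I)

FinWitnesses : Interp → Form → Set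
FinWitnesses I φ = (I ⊨ φ) × (∀ (a : Dom I) → ∃ λ x → (x ∈ vars φ) × (val I x ≡ a))

TUnsat : Form → Set₁
TUnsat φ = ∀ (I : Interp) → TInterp I → ¬ (I ⊨ φ)

FinitelyWitnessed : Form → Set₁
FinitelyWitnessed φ = TUnsat φ ∨c (Σ Interp λ I → TInterp I × FinWitnesses I φ)

IsEquivOn : List ℕ → (ℕ → ℕ → Bool) → Set
IsEquivOn V E =
    (∀ {x} → x ∈ V → E x x ≡ true)
  × (∀ {x y} → x ∈ V → y ∈ V → E x y ≡ true → E y x ≡ true)
  × (∀ {x y z} → x ∈ V → y ∈ V → z ∈ V → E x y ≡ true → E y z ≡ true → E x z ≡ true)

arrangement : List ℕ → (ℕ → ℕ → Bool) → Form
arrangement V E =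
  foldr _∧ᶠ_ ⊤ᶠ
    (concatMap (λ x → map (λ y → if E x y then x ≐ y else ¬ᶠ (x ≐ y)) V) V)

StronglyFinitelyWitnessed : Form → Set₁
StronglyFinitelyWitnessed φ =
  ∀ (V : List ℕ) (E : ℕ → ℕ → Bool) → IsEquivOn V E →
    FinitelyWitnessed (φ ∧ᶠ arrangement V E)

newVars : Form → Form → List ℕ
newVars φ ψ = filter (λ x → ¬? (x ∈? vars φ)) (vars ψ)

TEquivEx : Form → Form → Set₁
TEquivEx φ ψ = ∀ (I : Interp) → TInterp I →
  ((I ⊨ φ) → (I ⊨∃ newVars φ ψ ∙ ψ)) × ((I ⊨∃ newVars φ ψ ∙ ψ) → (I ⊨ φ))

IsStrongWitness : (Form → Form) → Set₁
IsStrongWitness wit = ∀ (φ : Form) → TEquivEx φ (wit φ) × StronglyFinitelyWitnessed (wit φ)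

-- computable strong witness: Agda functions are computable
StronglyFinitelyWitnessable : Set₁
StronglyFinitelyWitnessable = Σ (Form → Form) IsStrongWitness

-- Take ψ = wit(⊤). Since ⊤ holds in the two-element model 𝔹, so does ∃w⃗.ψ; fix a valuation
-- v : ℕ → Bool with 𝔹 v ⊨ ψ. If v is constant on vars ψ, the arrangement identifying all
-- variables of ψ is consistent with ψ in 𝔹, so a finite witness of ψ and this arrangement
-- would have exactly one element. Otherwise v splits vars ψ into two nonempty classes; adding
-- a fresh variable as a third class gives an arrangement consistent with ψ in a four-element
-- model, whose finite witnesses would have exactly three elements. Odd finite sizes are
-- excluded from the theory.
module Submission where

open import Defs
open import Data.Bool as Bool using (Bool; true; false; if_then_else_)
open import Data.Bool.Properties using (¬-not)
open import Data.Empty using (⊥)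
open import Data.Fin as Fin using (Fin; inject₁)
open import Data.Fin.Patterns using (0F; 1F; 2F)
open import Data.Fin.Permutation using (↔⇒≡)
open import Data.Fin.Properties using (inject₁-injective; 2↔Bool)
open import Data.List using (List; []; _∷_; map; concatMap; foldr)
open import Data.List.Extrema.Nat using (max; xs≤max)
open import Data.List.Membership.Propositional using (_∈_; find)
open import Data.List.Membership.Propositional.Properties
  using (∈-++⁻; ∈-++⁺ˡ; ∈-++⁺ʳ; ∈-map⁺; ∈-map⁻; ∈-concat⁺′; ∈-concat⁻′)
open import Data.List.Relation.Binary.Subset.Propositional using (_⊆_)
open import Data.List.Relation.Unary.All as All using (All; []; _∷_)
open import Data.List.Relation.Unary.All.Properties using (¬Any⇒All¬)
open import Data.List.Relation.Unary.Any using (Any; here; there; any?)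
open import Data.Nat using (ℕ; suc; _≟_; s≤s)
open import Data.Nat.Divisibility using (_∣_; _∣?_)
open import Data.Nat.Properties using (<-irrefl)
open import Data.Product using (_×_; ∃; _,_; proj₁)
open import Data.Product.Function.NonDependent.Propositional using (_×-⇔_)
open import Data.Sum using (_⊎_; inj₁; inj₂)
open import Data.Sum.Function.Propositional using (_⊎-⇔_)
open import Data.Unit using (tt)
open import Function using (_∘_; id)
open import Function.Bundles using (_↔_; _⇔_; mk⇔; mk↔ₛ′; Equivalence)
open import Function.Definitions using (Injective)
open import Function.Properties.Inverse using (↔-refl; ↔-sym; ↔-trans)
open import Function.Related.TypeIsomorphisms using (¬-cong-⇔)
open import Relation.Nullary using (¬_; yes; no; does; contradiction)
open import Relation.Nullary.Decidable using (dec-true; from-yes; from-no)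
open import Relation.Binary.PropositionalEquality using (_≡_; _≢_; refl; sym; trans; cong; subst)

open Equivalence using (to; from)

⊨-transport : (I J : Interp) (f : Dom I → Dom J) → Injective _≡_ _≡_ f →
  (φ : Form) → (∀ {x} → x ∈ vars φ → val J x ≡ f (val I x)) → (I ⊨ φ) ⇔ (J ⊨ φ)
⊨-transport I J f f-inj ⊤ᶠ agree = mk⇔ id id
⊨-transport I J f f-inj (x ≐ y) agree = mk⇔
  (λ e → trans (agree (here refl)) (trans (cong f e) (sym (agree (there (here refl))))))
  (λ e → f-inj (trans (sym (agree (here refl))) (trans e (agree (there (here refl))))))
⊨-transport I J f f-inj (¬ᶠ φ) agree = ¬-cong-⇔ (⊨-transport I J f f-inj φ agree)
⊨-transport I J f f-inj (φ ∧ᶠ ψ) agree =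
  ⊨-transport I J f f-inj φ (agree ∘ ∈-++⁺ˡ)
    ×-⇔ ⊨-transport I J f f-inj ψ (agree ∘ ∈-++⁺ʳ (vars φ))
⊨-transport I J f f-inj (φ ∨ᶠ ψ) agree =
  ⊨-transport I J f f-inj φ (agree ∘ ∈-++⁺ˡ)
    ⊎-⇔ ⊨-transport I J f f-inj ψ (agree ∘ ∈-++⁺ʳ (vars φ))

⊨-⋀⁺ : ∀ (I : Interp) fs → All (I ⊨_) fs → I ⊨ foldr _∧ᶠ_ ⊤ᶠ fs
⊨-⋀⁺ I [] [] = tt
⊨-⋀⁺ I (f ∷ fs) (I⊨f ∷ I⊨fs) = I⊨f , ⊨-⋀⁺ I fs I⊨fs

⊨-⋀⁻ : ∀ (I : Interp) fs → I ⊨ foldr _∧ᶠ_ ⊤ᶠ fs → All (I ⊨_) fs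
⊨-⋀⁻ I [] tt = []
⊨-⋀⁻ I (f ∷ fs) (I⊨f , I⊨fs) = I⊨f ∷ ⊨-⋀⁻ I fs I⊨fs

vars-⋀ : ∀ fs {x} → x ∈ vars (foldr _∧ᶠ_ ⊤ᶠ fs) → Any (λ f → x ∈ vars f) fs
vars-⋀ (f ∷ fs) x∈ with ∈-++⁻ (vars f) x∈
... | inj₁ x∈f = here x∈f
... | inj₂ x∈fs = there (vars-⋀ fs x∈fs)

literal : (ℕ → ℕ → Bool) → ℕ → ℕ → Form
literal E x y = if E x y then x ≐ y else ¬ᶠ (x ≐ y)

literals : List ℕ → (ℕ → ℕ → Bool) → List Form
literals V E = concatMap (λ x → map (literal E x) V) V

∈-literals⁺ : ∀ V E {x y} → x ∈ V → y ∈ V → literal E x y ∈ literals V E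
∈-literals⁺ V E {x} x∈V y∈V =
  ∈-concat⁺′ (∈-map⁺ (literal E x) y∈V) (∈-map⁺ (λ x → map (literal E x) V) x∈V)

∈-literals⁻ : ∀ V E {f} → f ∈ literals V E → ∃ λ x → ∃ λ y → x ∈ V × y ∈ V × f ≡ literal E x y
∈-literals⁻ V E f∈ with ∈-concat⁻′ (map (λ x → map (literal E x) V) V) f∈
... | _ , f∈row , row∈ with ∈-map⁻ (λ x → map (literal E x) V) row∈
... | x , x∈V , refl with ∈-map⁻ (literal E x) f∈row
... | y , y∈V , refl = x , y , x∈V , y∈V , refl

vars-literal : ∀ E x y {z} → z ∈ vars (literal E x y) → z ≡ x ⊎ z ≡ y
vars-literal E x y z∈ with E x y
vars-literal E x y (here refl)         | true  = inj₁ refl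
vars-literal E x y (there (here refl)) | true  = inj₂ refl
vars-literal E x y (here refl)         | false = inj₁ refl
vars-literal E x y (there (here refl)) | false = inj₂ refl

vars-arrangement : ∀ V E → vars (arrangement V E) ⊆ V
vars-arrangement V E z∈ with find (vars-⋀ (literals V E) z∈)
... | _ , f∈ , z∈f with ∈-literals⁻ V E f∈
... | x , y , x∈V , y∈V , refl with vars-literal E x y z∈f
... | inj₁ refl = x∈V
... | inj₂ refl = y∈V

sameColour : ∀ {m} → (ℕ → Fin m) → ℕ → ℕ → Bool
sameColour c x y = does (c x Fin.≟ c y)

≡⇒sameColour : ∀ {m} (c : ℕ → Fin m) {x y} → c x ≡ c y → sameColour c x y ≡ true
≡⇒sameColour c {x} {y} = dec-true (c x Fin.≟ c y)

sameColour⇒≡ : ∀ {m} (c : ℕ → Fin m) {x y} → sameColour c x y ≡ true → c x ≡ c y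
sameColour⇒≡ c {x} {y} same with c x Fin.≟ c y
... | yes cx≡cy = cx≡cy
... | no _ with () ← same

sameColour-isEquivOn : ∀ {m} (c : ℕ → Fin m) V → IsEquivOn V (sameColour c)
sameColour-isEquivOn c V =
  (λ _ → ≡⇒sameColour c refl) ,
  (λ _ _ → ≡⇒sameColour c ∘ sym ∘ sameColour⇒≡ c) ,
  (λ _ _ _ xy yz → ≡⇒sameColour c (trans (sameColour⇒≡ c xy) (sameColour⇒≡ c yz)))

-- Required only for nonempty V; harmless, as every domain contains val J 0 and must be named by V.
UsesAllColours : ∀ {m} → List ℕ → (ℕ → Fin m) → Set
UsesAllColours V c = (∃ λ x → x ∈ V) → ∀ i → ∃ λ x → x ∈ V × c x ≡ i

Realises : ∀ {m} → Interp → (ℕ → Fin m) → List ℕ → Set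
Realises I c V = ∀ {x y} → x ∈ V → y ∈ V → (val I x ≡ val I y) ⇔ (c x ≡ c y)

⊨-literal⁺ : ∀ {m} (I : Interp) (c : ℕ → Fin m) x y →
  (val I x ≡ val I y) ⇔ (c x ≡ c y) → I ⊨ literal (sameColour c) x y
⊨-literal⁺ I c x y I≡⇔c≡ with c x Fin.≟ c y
... | yes cx≡cy = from I≡⇔c≡ cx≡cy
... | no  cx≢cy = cx≢cy ∘ to I≡⇔c≡

⊨-literal⁻ : ∀ {m} (I : Interp) (c : ℕ → Fin m) x y →
  I ⊨ literal (sameColour c) x y → (val I x ≡ val I y) ⇔ (c x ≡ c y)
⊨-literal⁻ I c x y I⊨ with c x Fin.≟ c y
... | yes cx≡cy = mk⇔ (λ _ → cx≡cy) (λ _ → I⊨)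
... | no  cx≢cy = mk⇔ (λ e → contradiction e I⊨) (λ e → contradiction e cx≢cy)

⊨-arrangement⁺ : ∀ {m} (I : Interp) (c : ℕ → Fin m) V →
  Realises I c V → I ⊨ arrangement V (sameColour c)
⊨-arrangement⁺ I c V realises = ⊨-⋀⁺ I (literals V (sameColour c)) (All.tabulate I⊨literal)
  where
  I⊨literal : ∀ {f} → f ∈ literals V (sameColour c) → I ⊨ f
  I⊨literal f∈ with ∈-literals⁻ V (sameColour c) f∈
  ... | x , y , x∈V , y∈V , refl = ⊨-literal⁺ I c x y (realises x∈V y∈V)

⊨-arrangement⁻ : ∀ {m} (I : Interp) (c : ℕ → Fin m) V →
  I ⊨ arrangement V (sameColour c) → Realises I c V
⊨-arrangement⁻ I c V I⊨δ {x} {y} x∈V y∈V = ⊨-literal⁻ I c x y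
  (All.lookup (⊨-⋀⁻ I (literals V (sameColour c)) I⊨δ) (∈-literals⁺ V (sameColour c) x∈V y∈V))

arrangement-model↔Fin : ∀ {m} (J : Interp) (c : ℕ → Fin m) V →
  J ⊨ arrangement V (sameColour c) →
  (∀ a → ∃ λ x → x ∈ V × val J x ≡ a) →
  UsesAllColours V c →
  Dom J ↔ Fin m
arrangement-model↔Fin {m} J c V J⊨δ named onto =
  mk↔ₛ′ colourOf element colourOf∘element element∘colourOf
  where
  realises : Realises J c V
  realises = ⊨-arrangement⁻ J c V J⊨δ

  representative : ∀ i → ∃ λ x → x ∈ V × c x ≡ i
  representative = onto (let (x , x∈V , _) = named (val J 0) in x , x∈V)

  colourOf : Dom J → Fin m
  colourOf a = c (proj₁ (named a))

  element : Fin m → Dom J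
  element i = val J (proj₁ (representative i))

  colourOf∘element : ∀ i → colourOf (element i) ≡ i
  colourOf∘element i =
    let (y , y∈V , cy≡i) = representative i
        (x , x∈V , x≡y) = named (val J y)
    in trans (to (realises x∈V y∈V) x≡y) cy≡i

  element∘colourOf : ∀ a → element (colourOf a) ≡ a
  element∘colourOf a =
    let (x , x∈V , x≡a) = named a
        (y , y∈V , cy≡cx) = representative (c x)
    in trans (from (realises y∈V x∈V) cy≡cx) x≡a

odd⇒¬EvenOrInfinite : ∀ {m} {A : Set} → ¬ 2 ∣ m → A ↔ Fin m → ¬ EvenOrInfinite A
odd⇒¬EvenOrInfinite odd A↔m evenOrInfinite = evenOrInfinite λ
  { (inj₁ (n , 2∣n , A↔n)) → odd (subst (2 ∣_) (↔⇒≡ (↔-trans (↔-sym A↔n) A↔m)) 2∣n)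
  ; (inj₂ infinite) → infinite (_ , A↔m) }

¬finitelyWitnessed : ∀ {m} → ¬ 2 ∣ m → ∀ φ (K : Interp) → TInterp K → K ⊨ φ →
  (∀ J → FinWitnesses J φ → Dom J ↔ Fin m) → ¬ FinitelyWitnessed φ
¬finitelyWitnessed odd φ K K∈T K⊨φ size finitelyWitnessed = finitelyWitnessed λ
  { (inj₁ unsat) → unsat K K∈T K⊨φ
  ; (inj₂ (J , J∈T , J-witnesses)) → odd⇒¬EvenOrInfinite odd (size J J-witnesses) J∈T }

¬finitelyWitnessed-arrangement : ∀ {m} → ¬ 2 ∣ m → ∀ ψ V (c : ℕ → Fin m) →
  vars ψ ⊆ V → UsesAllColours V c →
  (K : Interp) → TInterp K → K ⊨ ψ → Realises K c V →
  ¬ FinitelyWitnessed (ψ ∧ᶠ arrangement V (sameColour c))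
¬finitelyWitnessed-arrangement odd ψ V c ψ⊆V onto K K∈T K⊨ψ realises =
  ¬finitelyWitnessed odd _ K K∈T (K⊨ψ , ⊨-arrangement⁺ K c V realises) λ
    { J ((_ , J⊨δ) , covered) → arrangement-model↔Fin J c V J⊨δ (named J covered) onto }
  where
  named : ∀ J → (∀ a → ∃ λ x → x ∈ vars (ψ ∧ᶠ arrangement V (sameColour c)) × val J x ≡ a) →
    ∀ a → ∃ λ x → x ∈ V × val J x ≡ a
  named J covered a with covered a
  ... | x , x∈ , x≡a with ∈-++⁻ (vars ψ) x∈
  ... | inj₁ x∈ψ = x , ψ⊆V x∈ψ , x≡a
  ... | inj₂ x∈δ = x , vars-arrangement V (sameColour c) x∈δ , x≡a

𝔹 : (ℕ → Bool) → Interp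
𝔹 v = record { struct = record { Carrier = Bool ; _≟ᶜ_ = Bool._≟_ } ; val = v }

𝔹∈T : ∀ v → TInterp (𝔹 v)
𝔹∈T v ¬evenOrInfinite = ¬evenOrInfinite (inj₁ (2 , from-yes (2 ∣? 2) , ↔-sym 2↔Bool))

𝔽₄ : (ℕ → Fin 4) → Interp
𝔽₄ v = record { struct = record { Carrier = Fin 4 ; _≟ᶜ_ = Fin._≟_ } ; val = v }

𝔽₄∈T : ∀ v → TInterp (𝔽₄ v)
𝔽₄∈T v ¬evenOrInfinite = ¬evenOrInfinite (inj₁ (4 , from-yes (2 ∣? 4) , ↔-refl))

bit : Bool → Fin 3
bit false = 0F
bit true  = 1F

bit-injective : Injective _≡_ _≡_ bit
bit-injective {false} {false} _ = refl
bit-injective {true}  {true}  _ = refl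

module _ (v : ℕ → Bool) (z : ℕ) where

  colourApart : ℕ → Fin 3
  colourApart x with x ≟ z
  ... | yes _ = 2F
  ... | no  _ = bit (v x)

  colourApart-≡ : colourApart z ≡ 2F
  colourApart-≡ with z ≟ z
  ... | yes _   = refl
  ... | no  z≢z = contradiction refl z≢z

  colourApart-≢ : ∀ {x} → x ≢ z → colourApart x ≡ bit (v x)
  colourApart-≢ {x} x≢z with x ≟ z
  ... | yes x≡z = contradiction x≡z x≢z
  ... | no  _   = refl

fresh : ∀ L {x} → x ∈ L → x ≢ suc (max 0 L)
fresh L x∈L x≡ = <-irrefl x≡ (s≤s (All.lookup (xs≤max 0 L) x∈L))

constant⊎twoValued : (v : ℕ → Bool) (L : List ℕ) →
  (∃ λ b → All (λ x → v x ≡ b) L) ⊎ (Any (λ x → v x ≡ true) L × Any (λ x → v x ≡ false) L)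
constant⊎twoValued v L with any? (λ x → v x Bool.≟ true) L | any? (λ x → v x Bool.≟ false) L
... | yes someTrue | yes someFalse = inj₂ (someTrue , someFalse)
... | no  noneTrue | _             = inj₁ (false , All.map ¬-not (¬Any⇒All¬ L noneTrue))
... | _            | no noneFalse  = inj₁ (true , All.map ¬-not (¬Any⇒All¬ L noneFalse))

¬SFW-constant : ∀ ψ → StronglyFinitelyWitnessed ψ → ∀ v → 𝔹 v ⊨ ψ →
  ∀ b → All (λ x → v x ≡ b) (vars ψ) → ⊥
¬SFW-constant ψ sfw v v⊨ψ b constant =
  ¬finitelyWitnessed-arrangement (from-no (2 ∣? 1)) ψ (vars ψ) c id onto
    (𝔹 v) (𝔹∈T v) v⊨ψ realises (sfw (vars ψ) (sameColour c) (sameColour-isEquivOn c (vars ψ)))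
  where
  c : ℕ → Fin 1
  c _ = 0F

  onto : UsesAllColours (vars ψ) c
  onto (x , x∈ψ) 0F = x , x∈ψ , refl

  realises : Realises (𝔹 v) c (vars ψ)
  realises x∈ψ y∈ψ =
    mk⇔ (λ _ → refl) (λ _ → trans (All.lookup constant x∈ψ) (sym (All.lookup constant y∈ψ)))

¬SFW-twoValued : ∀ ψ → StronglyFinitelyWitnessed ψ → ∀ v → 𝔹 v ⊨ ψ →
  Any (λ x → v x ≡ true) (vars ψ) → Any (λ x → v x ≡ false) (vars ψ) → ⊥
¬SFW-twoValued ψ sfw v v⊨ψ someTrue someFalse =
  ¬finitelyWitnessed-arrangement (from-no (2 ∣? 3)) ψ V c there onto
    K (𝔽₄∈T (inject₁ ∘ c)) K⊨ψ realises (sfw V (sameColour c) (sameColour-isEquivOn c V))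
  where
  z : ℕ
  z = suc (max 0 (vars ψ))

  V : List ℕ
  V = z ∷ vars ψ

  c : ℕ → Fin 3
  c = colourApart v z

  -- Three colours, but four elements: a three-element model is not in the theory.
  K : Interp
  K = 𝔽₄ (inject₁ ∘ c)

  c-on-ψ : ∀ {x} → x ∈ vars ψ → c x ≡ bit (v x)
  c-on-ψ x∈ψ = colourApart-≢ v z (fresh (vars ψ) x∈ψ)

  K⊨ψ : K ⊨ ψ
  K⊨ψ = to (⊨-transport (𝔹 v) K (inject₁ ∘ bit) (bit-injective ∘ inject₁-injective) ψ
             (cong inject₁ ∘ c-on-ψ)) v⊨ψ

  realises : Realises K c V
  realises _ _ = mk⇔ inject₁-injective (cong inject₁)

  hit : ∀ {b} → Any (λ x → v x ≡ b) (vars ψ) → ∃ λ x → x ∈ V × c x ≡ bit b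
  hit some with find some
  ... | x , x∈ψ , vx≡b = x , there x∈ψ , trans (c-on-ψ x∈ψ) (cong bit vx≡b)

  onto : UsesAllColours V c
  onto _ 0F = hit someFalse
  onto _ 1F = hit someTrue
  onto _ 2F = z , here refl , colourApart-≡ v z

¬SFW-𝔹 : ∀ ψ → StronglyFinitelyWitnessed ψ → ∀ v → ¬ (𝔹 v ⊨ ψ)
¬SFW-𝔹 ψ sfw v v⊨ψ with constant⊎twoValued v (vars ψ)
... | inj₁ (b , constant)         = ¬SFW-constant ψ sfw v v⊨ψ b constant
... | inj₂ (someTrue , someFalse) = ¬SFW-twoValued ψ sfw v v⊨ψ someTrue someFalse

lemma7 : ¬ StronglyFinitelyWitnessable
lemma7 (wit , isStrongWitness) =
  let (⊤⇔∃ψ , sfw) = isStrongWitness ⊤ᶠ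
      𝔹⊨∃ψ = proj₁ (⊤⇔∃ψ (𝔹 (λ _ → false)) (𝔹∈T (λ _ → false))) tt
  in 𝔹⊨∃ψ λ (v , _ , v⊨ψ) → ¬SFW-𝔹 (wit ⊤ᶠ) sfw v v⊨ψ
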